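{- Let $\sigma\in\mathfrak{S}_n$ and $x\in[n]$. If $x$ is a left-to-right (resp. right-to-left) minimum of $\sigma$, then $x$ is a right-to-left (resp. left-to-right) minimum of $\psi_x(\sigma)$. Moreover, $\widetilde{\mathrm{M}}(\psi_x(\sigma))=\widetilde{\mathrm{M}}(\sigma)$ for every $\sigma\in\mathfrak{S}_n$ and $x\in[n]$.
   Context: For $\sigma\in\mathfrak{S}_n$ with $\mathrm{lmi}(\sigma)-1=k$ and $\mathrm{rmi}(\sigma)-1=l$ (numbers of left-to-right minima and right-to-left minima minus one), the bi-basic decomposition is the unique factorization $\sigma=\alpha_1\alpha_2\cdots\alpha_k\,1\,\beta_1\beta_2\cdots\beta_l$ into consecutive words (blocks) such that the first letter of each $\alpha_i$ is its smallest letter and is a left-to-right minimum of $\sigma$, and the last letter of each $\beta_i$ is its smallest letter and is a right-to-left minimum of $\sigma$. For a word $w=w_1\cdots w_d$, $w^r=w_d\cdots w_1$. The map $\psi_x$ is defined by: (1) if $x$ is the first letter of some $\alpha_i$, $\psi_x(\sigma)$ is obtained by deleting the block $\alpha_i$ and inserting $\alpha_i^r$ into the unique gap between blocks to the right of $1$ such that $x$ becomes a right-to-left minimum (i.e. immediately before the first block $\beta_j$ whose smallest letter exceeds $x$, or at the end if there is none); (2) if $x$ is the last letter of some $\beta_i$, $\psi_x(\sigma)$ is obtained by deleting $\beta_i$ and inserting $\beta_i^r$ into the unique gap between blocks to the left of $1$ such that $x$ becomes a left-to-right minimum (i.e. immediately before the first block $\alpha_j$ whose smallest letter is less than $x$,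 or immediately before $1$ if there is none); (3) otherwise $\psi_x(\sigma)=\sigma$. $\widetilde{\mathrm{M}}(\sigma)$ is the number of $i\in[n]$ with $\sigma_{i-1}<\sigma_i>\sigma_{i+1}$ under the convention $\sigma_0=\sigma_{n+1}=+\infty$. -}

module Defs where

open import Data.Nat using (ℕ; zero; suc; _+_; _<_; _<ᵇ_; _≟_)
open import Data.Bool using (Bool; true; false; if_then_else_; _∧_)
open import Data.List using (List; []; _∷_; _++_; reverse; concat; map; head)
open import Data.Maybe using (Maybe; just; nothing)
open import Data.Product using (_×_; _,_; Σ; ∃)
open import Data.List.Relation.Unary.All using (All)
open import Relation.Nullary.Decidable using (⌊_⌋)
open import Relation.Binary.PropositionalEquality using (_≡_)

-- Permutations of [n] = {1,…,n} in one-line notation are lists of naturals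
-- that are a rearrangement of 1,2,…,n.
-- (Membership in 𝔖_n is stated via Permutation._↭_.)

LRmin : ℕ → List ℕ → Set
LRmin x w = Σ (List ℕ) λ p → Σ (List ℕ) λ s → (w ≡ p ++ (x ∷ s)) × All (x <_) p

RLmin : ℕ → List ℕ → Set
RLmin x w = Σ (List ℕ) λ p → Σ (List ℕ) λ s → (w ≡ p ++ (x ∷ s)) × All (x <_) s

hd : List ℕ → ℕ
hd []      = 0
hd (a ∷ _) = a

lst : List ℕ → ℕ
lst w = hd (reverse w)

splitAt1 : List ℕ → List ℕ × List ℕ
splitAt1 [] = [] , []
splitAt1 (a ∷ w) with ⌊ a ≟ 1 ⌋
... | true  = [] , w
... | false with splitAt1 w
...   | (A , B) = (a ∷ A) , B

-- α-blocks of a word A: factorization of A into consecutive blocks, each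
-- beginning at a left-to-right minimum of A (the first letter of each block
-- is its smallest letter).  `go h acc rest`: current block is h followed by
-- reverse acc.
alphasGo : ℕ → List ℕ → List ℕ → List (List ℕ)
alphasGo h acc []      = (h ∷ reverse acc) ∷ []
alphasGo h acc (y ∷ w) with y <ᵇ h
... | true  = (h ∷ reverse acc) ∷ alphasGo y [] w
... | false = alphasGo h (y ∷ acc) w

alphas : List ℕ → List (List ℕ)
alphas []      = []
alphas (a ∷ w) = alphasGo a [] w

betas : List ℕ → List (List ℕ)
betas B = map reverse (reverse (alphas (reverse B)))

extract : (List ℕ → Bool) → List (List ℕ) → Maybe (List ℕ × List (List ℕ))
extract p [] = nothing
extract p (b ∷ bs) with p b
... | true  = just (b , bs)
... | false with extract p bs
...   | nothing        = nothing
...   | just (c , cs)  = just (c , b ∷ cs)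

insertBefore : (List ℕ → Bool) → List ℕ → List (List ℕ) → List (List ℕ)
insertBefore p c [] = c ∷ []
insertBefore p c (b ∷ bs) with p b
... | true  = c ∷ b ∷ bs
... | false = b ∷ insertBefore p c bs

ψ : ℕ → List ℕ → List ℕ
ψ x σ with splitAt1 σ
... | (A , B) with extract (λ b → ⌊ hd b ≟ x ⌋) (alphas A)
...   | just (α , as) =
          concat as ++ (1 ∷ concat (insertBefore (λ b → x <ᵇ lst b) (reverse α) (betas B)))
...   | nothing with extract (λ b → ⌊ lst b ≟ x ⌋) (betas B)
...     | just (β , bs) =
          concat (insertBefore (λ a → hd a <ᵇ x) (reverse β) (alphas A)) ++ (1 ∷ concat bs)
...     | nothing = σ

-- a > b where b = nothing stands for +∞
gtM : ℕ → Maybe ℕ → Bool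
gtM a nothing  = false
gtM a (just b) = b <ᵇ a

-- number of peaks σ_{i-1} < σ_i > σ_{i+1} with σ_0 = σ_{n+1} = +∞;
-- the first argument is the previous letter (nothing = +∞)
peaksFrom : Maybe ℕ → List ℕ → ℕ
peaksFrom p []      = 0
peaksFrom p (a ∷ w) = (if gtM a p ∧ gtM a (head w) then 1 else 0) + peaksFrom (just a) w

Mtilde : List ℕ → ℕ
Mtilde σ = peaksFrom nothing σ

{-# OPTIONS --safe #-}
module Submission where

-- Write σ = α₁⋯αₖ 1 β₁⋯βₗ.  At every block boundary σ either descends into the minimum of the
-- next α-block (or into 1) or ascends from the minimum of the previous β-block, so whether a
-- letter is a peak is decided inside its block: M̃(σ) is the sum of the peak counts of the
-- blocks, an α-block taken between +∞ and −∞ and a β-block between −∞ and +∞, which is the count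
-- of its reverse taken as an α-block.  ψₓ moves one block to the other side of 1 and reverses
-- it; as the letters are distinct, the insertion point keeps the block minima monotone, so the
-- result is again a bi-basic decomposition with the same block counts, in which x ends its
-- β-block (starts its α-block) and all later (earlier) blocks have larger minima.  If x starts
-- no α-block and ends no β-block, it is a left-to-right or right-to-left minimum only if x = 1.

open import Defs
open import Data.Bool using (true; false; if_then_else_; _∧_; T)
open import Data.Bool.Properties using (∧-comm; T-≡; ¬-not)
open import Data.Empty using (⊥-elim)
open import Data.List using (List; []; _∷_; _++_; [_]; reverse; concat; map; upTo)
open import Data.List.Properties using (∷-injective; ++-assoc; ++-identityʳ; unfold-reverse; reverse-involutive; reverse-++; concat-++; map-++)
open import Data.List.Membership.Propositional using (_∈_)
open import Data.List.Membership.Propositional.Properties using (∈-++⁺ʳ; ∈-concat⁺′; ∈-∃++)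
open import Data.List.Relation.Unary.All as All using (All; []; _∷_)
import Data.List.Relation.Unary.All.Properties as All
open import Data.List.Relation.Unary.All.Properties using (All¬⇒¬Any)
open import Data.List.Relation.Unary.AllPairs as AllPairs using (AllPairs; []; _∷_)
import Data.List.Relation.Unary.AllPairs.Properties as AllPairs
open import Data.List.Relation.Unary.Any as Any using (Any; here; there)
import Data.List.Relation.Unary.Any.Properties as Any
open import Data.List.Relation.Unary.Unique.Propositional using (Unique)
import Data.List.Relation.Unary.Unique.Propositional.Properties as Unique
open import Data.List.Relation.Binary.Permutation.Propositional using (_↭_; ↭-refl; ↭-sym; ↭-trans; prep; swap; ↭⇒↭ₛ)
import Data.List.Relation.Binary.Permutation.Propositional.Properties as ↭
open import Data.List.Relation.Binary.Permutation.Propositional.Properties using (All-resp-↭; Any-resp-↭)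
open import Data.Maybe using (Maybe; just; nothing)
open import Data.Nat using (ℕ; zero; suc; _≤_; _<_; _<ᵇ_; _≟_; _+_; z≤n; z<s)
open import Data.Nat.ListAction using (sum)
open import Data.Nat.ListAction.Properties using (sum-↭)
open import Data.Nat.Properties using (suc-injective; +-comm; +-assoc; ≤-refl; ≤-trans; <-trans; <-≤-trans; ≤-<-trans; <-irrefl; <⇒≤; <⇒≱; ≮⇒≥; ≤∧≢⇒<; <ᵇ⇒<; <⇒<ᵇ)
open import Data.Product using (_×_; _,_; proj₁; proj₂)
open import Data.Sum using (_⊎_; inj₁; inj₂)
open import Function using (_∘_; flip)
open import Function.Bundles using (Equivalence)
open import Relation.Binary.Core using (Rel)
open import Relation.Binary.Definitions using (Transitive)
open import Relation.Binary.PropositionalEquality using (_≡_; _≢_; refl; sym; trans; cong; cong₂; subst; subst₂; ≢-sym; setoid; module ≡-Reasoning)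
open import Data.List.Relation.Binary.Permutation.Setoid.Properties (setoid ℕ) using (Unique-resp-↭)
open import Relation.Nullary using (¬_; yes; no)
open import Relation.Nullary.Decidable using (⌊_⌋; toWitness; fromWitness)

<⇒<ᵇ≡true : ∀ {m n} → m < n → (m <ᵇ n) ≡ true
<⇒<ᵇ≡true = Equivalence.to T-≡ ∘ <⇒<ᵇ

<ᵇ≡true⇒< : ∀ {m n} → (m <ᵇ n) ≡ true → m < n
<ᵇ≡true⇒< {m} {n} = <ᵇ⇒< m n ∘ Equivalence.from T-≡

≤⇒<ᵇ≡false : ∀ {m n} → n ≤ m → (m <ᵇ n) ≡ false
≤⇒<ᵇ≡false n≤m = ¬-not (λ m<ᵇn → <⇒≱ (<ᵇ≡true⇒< m<ᵇn) n≤m)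

<ᵇ≡false⇒≤ : ∀ {m n} → (m <ᵇ n) ≡ false → n ≤ m
<ᵇ≡false⇒≤ {m} {n} m≮ᵇn = ≮⇒≥ (λ m<n → subst T m≮ᵇn (<⇒<ᵇ m<n))

⌊≟⌋≡true⇒≡ : ∀ {m n} → ⌊ m ≟ n ⌋ ≡ true → m ≡ n
⌊≟⌋≡true⇒≡ eq = toWitness (subst T (sym eq) _)

⌊≟⌋≡false⇒≢ : ∀ {m n} → ⌊ m ≟ n ⌋ ≡ false → m ≢ n
⌊≟⌋≡false⇒≢ {m} eq refl = subst T eq (fromWitness {a? = m ≟ m} refl)

≢⇒⌊≟⌋≡false : ∀ {m n} → m ≢ n → ⌊ m ≟ n ⌋ ≡ false
≢⇒⌊≟⌋≡false {m} {n} m≢n with m ≟ n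
... | yes m≡n = ⊥-elim (m≢n m≡n)
... | no  _   = refl

All-reverse⁺ : ∀ {a p} {A : Set a} {P : A → Set p} {xs} → All P xs → All P (reverse xs)
All-reverse⁺ pw = All.tabulate (All.lookup pw ∘ Any.reverse⁻)

All-reverse⁻ : ∀ {a p} {A : Set a} {P : A → Set p} {xs} → All P (reverse xs) → All P xs
All-reverse⁻ pw = All.tabulate (All.lookup pw ∘ Any.reverse⁺)

AllPairs-++⁻ : ∀ {a ℓ} {A : Set a} {R : Rel A ℓ} xs {ys} → AllPairs R (xs ++ ys) →
               AllPairs R xs × AllPairs R ys × All (λ x → All (R x) ys) xs
AllPairs-++⁻ []       rs         = [] , rs , []
AllPairs-++⁻ (x ∷ xs) (r ∷ rs) with AllPairs-++⁻ xs rs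
... | rxs , rys , cross = All.++⁻ˡ xs r ∷ rxs , rys , All.++⁻ʳ xs r ∷ cross

AllPairs-reverse⁺ : ∀ {a ℓ} {A : Set a} {R : Rel A ℓ} {xs} → AllPairs R xs → AllPairs (flip R) (reverse xs)
AllPairs-reverse⁺ {xs = []}     []       = []
AllPairs-reverse⁺ {xs = x ∷ xs} (r ∷ rs) rewrite unfold-reverse x xs =
  AllPairs.++⁺ (AllPairs-reverse⁺ rs) ([] ∷ []) (All.map (_∷ []) (All-reverse⁺ r))

lst-reverse : ∀ w → lst (reverse w) ≡ hd w
lst-reverse w = cong hd (reverse-involutive w)

lst-∷∷ : ∀ a b w → lst (a ∷ b ∷ w) ≡ lst (b ∷ w)
lst-∷∷ a b w rewrite unfold-reverse a (b ∷ w) | unfold-reverse b w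
                   | ++-assoc (reverse w) [ b ] [ a ] = hd-++ (reverse w)
  where
  hd-++ : ∀ u → hd (u ++ b ∷ a ∷ []) ≡ hd (u ++ b ∷ [])
  hd-++ []      = refl
  hd-++ (_ ∷ _) = refl

All⇒lst-∷ : ∀ {P : ℕ → Set} {a w} → All P (a ∷ w) → P (lst (a ∷ w))
All⇒lst-∷ {w = []}    (pa ∷ _)  = pa
All⇒lst-∷ {P} {a} {b ∷ w} (_ ∷ pw) = subst P (sym (lst-∷∷ a b w)) (All⇒lst-∷ pw)

-- Peaks between prescribed neighbours

firstOr : List ℕ → Maybe ℕ → Maybe ℕ
firstOr []      r = r
firstOr (b ∷ _) r = just b

lastOr : List ℕ → Maybe ℕ → Maybe ℕ
lastOr []      l = l
lastOr (a ∷ w) l = lastOr w (just a)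

-- Neighbours are optional letters, nothing standing for +∞ as in gtM.
peakAt : Maybe ℕ → ℕ → Maybe ℕ → ℕ
peakAt l a r = if gtM a l ∧ gtM a r then 1 else 0

peaks : Maybe ℕ → List ℕ → Maybe ℕ → ℕ
peaks l []      r = 0
peaks l (a ∷ w) r = peakAt l a (firstOr w r) + peaks (just a) w r

peaksFrom≡peaks : ∀ l w → peaksFrom l w ≡ peaks l w nothing
peaksFrom≡peaks l []          = refl
peaksFrom≡peaks l (a ∷ [])    = refl
peaksFrom≡peaks l (a ∷ b ∷ w) = cong (peakAt l a (just b) +_) (peaksFrom≡peaks (just a) (b ∷ w))

firstOr-++ : ∀ u v r → firstOr (u ++ v) r ≡ firstOr u (firstOr v r)
firstOr-++ []      v r = refl
firstOr-++ (a ∷ u) v r = refl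

lastOr-++ : ∀ u v l → lastOr (u ++ v) l ≡ lastOr v (lastOr u l)
lastOr-++ []      v l = refl
lastOr-++ (a ∷ u) v l = lastOr-++ u v (just a)

peaks-++ : ∀ l u v r → peaks l (u ++ v) r ≡ peaks l u (firstOr v r) + peaks (lastOr u l) v r
peaks-++ l []      v r = refl
peaks-++ l (a ∷ u) v r rewrite firstOr-++ u v r | peaks-++ (just a) u v r =
  sym (+-assoc (peakAt l a (firstOr u (firstOr v r))) _ _)

lastOr-reverse : ∀ w l → lastOr (reverse w) l ≡ firstOr w l
lastOr-reverse []      l = refl
lastOr-reverse (a ∷ w) l rewrite unfold-reverse a w | lastOr-++ (reverse w) [ a ] l = refl

peaks-reverse : ∀ l w r → peaks l (reverse w) r ≡ peaks r w l
peaks-reverse l []      r = refl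
peaks-reverse l (a ∷ w) r
  rewrite unfold-reverse a w | peaks-++ l (reverse w) [ a ] r | peaks-reverse l w (just a)
        | lastOr-reverse w l | ∧-comm (gtM a (firstOr w l)) (gtM a r)
        | +-comm (peakAt r a (firstOr w l)) 0 =
  +-comm (peaks (just a) w l) _

lastOr-∷ : ∀ a w l → lastOr (a ∷ w) l ≡ just (lst (a ∷ w))
lastOr-∷ a []      l = refl
lastOr-∷ a (b ∷ w) l = trans (lastOr-∷ b w (just a)) (cong just (sym (lst-∷∷ a b w)))

peaks-congʳ : ∀ {r r′} l a w → gtM (lst (a ∷ w)) r ≡ gtM (lst (a ∷ w)) r′ →
              peaks l (a ∷ w) r ≡ peaks l (a ∷ w) r′
peaks-congʳ l a []      e rewrite e = refl
peaks-congʳ l a (b ∷ w) e rewrite lst-∷∷ a b w = cong (peakAt l a (just b) +_) (peaks-congʳ (just a) b w e)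

peaks-cong : ∀ {l l′ r r′} a w → gtM a l ≡ gtM a l′ → gtM (lst (a ∷ w)) r ≡ gtM (lst (a ∷ w)) r′ →
             peaks l (a ∷ w) r ≡ peaks l′ (a ∷ w) r′
peaks-cong {l′ = l′} {r} a w el er =
  trans (cong (λ z → (if z ∧ gtM a (firstOr w r) then 1 else 0) + peaks (just a) w r) el) (peaks-congʳ l′ a w er)

-- Left-to-right and right-to-left minima

LRmin⇒∈ : ∀ {x w} → LRmin x w → x ∈ w
LRmin⇒∈ (p , _ , refl , _) = ∈-++⁺ʳ p (here refl)

RLmin⇒∈ : ∀ {x w} → RLmin x w → x ∈ w
RLmin⇒∈ (p , _ , refl , _) = ∈-++⁺ʳ p (here refl)

LRmin-++ʳ : ∀ {x u} v → LRmin x u → LRmin x (u ++ v)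
LRmin-++ʳ {x} v (p , s , refl , x<p) = p , s ++ v , ++-assoc p (x ∷ s) v , x<p

LRmin-++ˡ : ∀ {x u v} → All (x <_) u → LRmin x v → LRmin x (u ++ v)
LRmin-++ˡ {x} {u} x<u (p , s , refl , x<p) = u ++ p , s , sym (++-assoc u p (x ∷ s)) , All.++⁺ x<u x<p

RLmin-++ˡ : ∀ {x v} u → RLmin x v → RLmin x (u ++ v)
RLmin-++ˡ {x} u (p , s , refl , x<s) = u ++ p , s , sym (++-assoc u p (x ∷ s)) , x<s

RLmin-++ʳ : ∀ {x u v} → RLmin x u → All (x <_) v → RLmin x (u ++ v)
RLmin-++ʳ {x} {v = v} (p , s , refl , x<s) x<v = p , s ++ v , ++-assoc p (x ∷ s) v , All.++⁺ x<s x<v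

LRmin-concat : ∀ {x c} pre post → All (All (x <_)) pre → LRmin x c → LRmin x (concat (pre ++ c ∷ post))
LRmin-concat {c = c} pre post x<pre m =
  subst (LRmin _) (concat-++ pre (c ∷ post)) (LRmin-++ˡ (All.concat⁺ x<pre) (LRmin-++ʳ (concat post) m))

RLmin-concat : ∀ {x c} pre post → RLmin x c → All (All (x <_)) post → RLmin x (concat (pre ++ c ∷ post))
RLmin-concat {c = c} pre post m x<post =
  subst (RLmin _) (concat-++ pre (c ∷ post)) (RLmin-++ˡ (concat pre) (RLmin-++ʳ m (All.concat⁺ x<post)))

LRmin-++-∷ : ∀ {x y} A B → y ≤ x → LRmin x (A ++ y ∷ B) → x ≡ y ⊎ LRmin x A
LRmin-++-∷ []      B y≤x ([]    , s , eq , _)        = inj₁ (sym (proj₁ (∷-injective eq)))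
LRmin-++-∷ []      B y≤x (q ∷ p , s , eq , x<q ∷ _)  rewrite proj₁ (∷-injective eq) = ⊥-elim (<⇒≱ x<q y≤x)
LRmin-++-∷ (a ∷ A) B y≤x ([]    , s , eq , _)        rewrite proj₁ (∷-injective eq) = inj₂ ([] , A , refl , [])
LRmin-++-∷ (a ∷ A) B y≤x (q ∷ p , s , eq , x<q ∷ x<p) with ∷-injective eq
... | refl , eq′ with LRmin-++-∷ A B y≤x (p , s , eq′ , x<p)
...   | inj₁ x≡y                  = inj₁ x≡y
...   | inj₂ (p′ , s′ , refl , x<p′) = inj₂ (q ∷ p′ , s′ , refl , x<q ∷ x<p′)

RLmin-++-∷ : ∀ {x y} A B → y ≤ x → RLmin x (A ++ y ∷ B) → x ≡ y ⊎ RLmin x B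
RLmin-++-∷ []      B y≤x ([]    , s , eq , _)   = inj₁ (sym (proj₁ (∷-injective eq)))
RLmin-++-∷ []      B y≤x (q ∷ p , s , eq , x<s) = inj₂ (p , s , proj₂ (∷-injective eq) , x<s)
RLmin-++-∷ (a ∷ A) B y≤x ([]    , s , eq , x<s) rewrite sym (proj₂ (∷-injective eq)) =
  ⊥-elim (<⇒≱ (All.head (All.++⁻ʳ A x<s)) y≤x)
RLmin-++-∷ (a ∷ A) B y≤x (q ∷ p , s , eq , x<s) = RLmin-++-∷ A B y≤x (p , s , proj₂ (∷-injective eq) , x<s)

RLmin⇒LRmin-reverse : ∀ {x w} → RLmin x w → LRmin x (reverse w)
RLmin⇒LRmin-reverse {x} (p , s , refl , x<s) = reverse s , reverse p , reverse-++-∷ , All-reverse⁺ x<s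
  where
  reverse-++-∷ : reverse (p ++ x ∷ s) ≡ reverse s ++ x ∷ reverse p
  reverse-++-∷ = trans (reverse-++ p (x ∷ s))
                       (trans (cong (_++ reverse p) (unfold-reverse x s)) (++-assoc (reverse s) [ x ] (reverse p)))

-- Chains of blocks

data StartsWithMin : List ℕ → Set where
  startsWithMin : ∀ {m w} → All (m ≤_) w → StartsWithMin (m ∷ w)

EndsWithMin : List ℕ → Set
EndsWithMin b = StartsWithMin (reverse b)

AlphaChain : List (List ℕ) → Set
AlphaChain as = All StartsWithMin as × AllPairs (λ a a′ → hd a′ < hd a) as

BetaChain : List (List ℕ) → Set
BetaChain bs = All EndsWithMin bs × AllPairs (λ b b′ → lst b < lst b′) bs

StartsWithMin⇒hd≤ : ∀ {a} → StartsWithMin a → All (hd a ≤_) a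
StartsWithMin⇒hd≤ (startsWithMin m≤w) = ≤-refl ∷ m≤w

EndsWithMin⇒lst≤ : ∀ {b} → EndsWithMin b → All (lst b ≤_) b
EndsWithMin⇒lst≤ = All-reverse⁻ ∘ StartsWithMin⇒hd≤

All⇒hd : ∀ {P : ℕ → Set} {a} → StartsWithMin a → All P a → P (hd a)
All⇒hd (startsWithMin _) (pm ∷ _) = pm

All⇒lst : ∀ {P : ℕ → Set} {b} → EndsWithMin b → All P b → P (lst b)
All⇒lst e = All⇒hd e ∘ All-reverse⁺

StartsWithMin⇒EndsWithMin-reverse : ∀ {a} → StartsWithMin a → EndsWithMin (reverse a)
StartsWithMin⇒EndsWithMin-reverse {a} = subst StartsWithMin (sym (reverse-involutive a))

hd∈ : ∀ {a} → StartsWithMin a → hd a ∈ a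
hd∈ (startsWithMin _) = here refl

lst∈ : ∀ {b} → EndsWithMin b → lst b ∈ b
lst∈ = Any.reverse⁻ ∘ hd∈

LRmin-hd : ∀ {a} → StartsWithMin a → LRmin (hd a) a
LRmin-hd (startsWithMin {w = w} _) = [] , w , refl , []

RLmin-lst : ∀ {b} → EndsWithMin b → RLmin (lst b) b
RLmin-lst {b} ends = subst (RLmin (lst b)) (reverse-involutive b) (RLmin-hd-reverse ends)
  where
  RLmin-hd-reverse : ∀ {a} → StartsWithMin a → RLmin (hd a) (reverse a)
  RLmin-hd-reverse (startsWithMin {m} {w} _) = reverse w , [] , unfold-reverse m w , []

AlphaChain⇒LRmin : ∀ {as a} → AlphaChain as → a ∈ as → LRmin (hd a) (concat as)
AlphaChain⇒LRmin (starts , sorted) a∈as with ∈-∃++ a∈as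
... | pre , post , refl with All.++⁻ pre starts | AllPairs-++⁻ pre sorted
...   | starts-pre , startsₐ ∷ _ | _ , _ , before =
  LRmin-concat pre post (All.zipWith (λ (s , a<hd) → All.map (<-≤-trans a<hd) (StartsWithMin⇒hd≤ s))
                                     (starts-pre , All.map All.head before))
               (LRmin-hd startsₐ)

BetaChain⇒RLmin : ∀ {bs b} → BetaChain bs → b ∈ bs → RLmin (lst b) (concat bs)
BetaChain⇒RLmin (ends , sorted) b∈bs with ∈-∃++ b∈bs
... | pre , post , refl with All.++⁻ʳ pre ends | AllPairs-++⁻ pre sorted
...   | endsᵦ ∷ ends-post | _ , after ∷ _ , _ =
  RLmin-concat pre post (RLmin-lst endsᵦ)
               (All.zipWith (λ (e , lst<) → All.map (<-≤-trans lst<) (EndsWithMin⇒lst≤ e)) (ends-post , after))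

-- Peaks of a bi-basic decomposition

-- The letters of a block exceed 1, so 0 acts as −∞.
alphaPeaks : List ℕ → ℕ
alphaPeaks a = peaks nothing a (just 0)

betaPeaks : List ℕ → ℕ
betaPeaks b = peaks (just 0) b nothing

betaPeaks-reverse : ∀ a → betaPeaks (reverse a) ≡ alphaPeaks a
betaPeaks-reverse a = peaks-reverse (just 0) a nothing

alphaPeaks-reverse : ∀ b → alphaPeaks (reverse b) ≡ betaPeaks b
alphaPeaks-reverse b = peaks-reverse nothing b (just 0)

alphaSum betaSum : List (List ℕ) → ℕ
alphaSum as = sum (map alphaPeaks as)
betaSum  bs = sum (map betaPeaks bs)

blockPeaks : List (List ℕ) → List (List ℕ) → ℕ
blockPeaks as bs = alphaSum as + betaSum bs

firstOr-alphaChain-below : ∀ {as z} w r → All StartsWithMin as → All (λ a → hd a < z) as → 1 < z →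
                           gtM z (firstOr (concat as ++ 1 ∷ w) r) ≡ true
firstOr-alphaChain-below w r []                      []          1<z = <⇒<ᵇ≡true 1<z
firstOr-alphaChain-below w r (startsWithMin _ ∷ _) (m<z ∷ _) _   = <⇒<ᵇ≡true m<z

firstOr-betaChain-above : ∀ {bs z} → All EndsWithMin bs → All (λ b → z < lst b) bs →
                    gtM z (firstOr (concat bs) nothing) ≡ false
firstOr-betaChain-above []                                  []          = refl
firstOr-betaChain-above {[] ∷ _}     (() ∷ _)               _
firstOr-betaChain-above {(a ∷ w) ∷ _} (ends ∷ _) (z<lst ∷ _) =
  ≤⇒<ᵇ≡false (<⇒≤ (<-≤-trans z<lst (All.head (EndsWithMin⇒lst≤ {a ∷ w} ends))))

lastOr-not-below-1 : ∀ {l w} → gtM 1 l ≡ false → All (1 <_) w → gtM 1 (lastOr w l) ≡ false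
lastOr-not-below-1 l≥1 []          = l≥1
lastOr-not-below-1 _   (1<a ∷ w>1) = lastOr-not-below-1 (≤⇒<ᵇ≡false (<⇒≤ 1<a)) w>1

peaks-alphaChain : ∀ {as} l w r → AlphaChain as → All (All (1 <_)) as → All (λ a → gtM (hd a) l ≡ false) as →
                   peaks l (concat as ++ 1 ∷ w) r ≡ alphaSum as + peaks (lastOr (concat as) l) (1 ∷ w) r
peaks-alphaChain l w r ([] , []) _ _ = refl
peaks-alphaChain {(m ∷ t) ∷ as} l w r (startsWithMin m≤t ∷ starts , below ∷ sorted) (a>1 ∷ as>1) (l≯m ∷ _) =
  begin
    peaks l (((m ∷ t) ++ concat as) ++ rest) r
  ≡⟨ cong (λ v → peaks l v r) (++-assoc (m ∷ t) (concat as) rest) ⟩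
    peaks l ((m ∷ t) ++ concat as ++ rest) r
  ≡⟨ peaks-++ l (m ∷ t) (concat as ++ rest) r ⟩
    peaks l (m ∷ t) (firstOr (concat as ++ rest) r) + peaks (lastOr (m ∷ t) l) (concat as ++ rest) r
  ≡⟨ cong₂ _+_ (peaks-cong {l} {nothing} m t l≯m lastIsPeak)
               (cong (λ l′ → peaks l′ (concat as ++ rest) r) (lastOr-∷ m t l)) ⟩
    alphaPeaks (m ∷ t) + peaks (just z) (concat as ++ rest) r
  ≡⟨ cong (alphaPeaks (m ∷ t) +_) (peaks-alphaChain (just z) w r (starts , sorted) as>1 laterHeadsBelow) ⟩
    alphaPeaks (m ∷ t) + (alphaSum as + peaks (lastOr (concat as) (just z)) rest r)
  ≡⟨ sym (+-assoc (alphaPeaks (m ∷ t)) (alphaSum as) _) ⟩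
    alphaSum ((m ∷ t) ∷ as) + peaks (lastOr (concat as) (just z)) rest r
  ≡⟨ cong (λ l′ → alphaSum ((m ∷ t) ∷ as) + peaks l′ rest r) lastOr-concat ⟩
    alphaSum ((m ∷ t) ∷ as) + peaks (lastOr ((m ∷ t) ++ concat as) l) rest r
  ∎
  where
  open ≡-Reasoning
  rest : List ℕ
  rest = 1 ∷ w
  z : ℕ
  z = lst (m ∷ t)
  m≤z : m ≤ z
  m≤z = All⇒lst-∷ {a = m} {t} (≤-refl ∷ m≤t)
  lastIsPeak : gtM z (firstOr (concat as ++ rest) r) ≡ gtM z (just 0)
  lastIsPeak = trans (firstOr-alphaChain-below w r starts (All.map (λ a<m → <-≤-trans a<m m≤z) below) 1<z)
                     (sym (<⇒<ᵇ≡true (<-trans z<s 1<z)))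
    where
    1<z : 1 < z
    1<z = <-≤-trans (All.head a>1) m≤z
  laterHeadsBelow : All (λ a → gtM (hd a) (just z) ≡ false) as
  laterHeadsBelow = All.map (λ a<m → ≤⇒<ᵇ≡false (<⇒≤ (<-≤-trans a<m m≤z))) below
  lastOr-concat : lastOr (concat as) (just z) ≡ lastOr ((m ∷ t) ++ concat as) l
  lastOr-concat = sym (trans (lastOr-++ (m ∷ t) (concat as) l) (cong (lastOr (concat as)) (lastOr-∷ m t l)))

peaks-betaChain : ∀ {bs} y → BetaChain bs → All (λ b → y < lst b) bs →
                  peaks (just y) (concat bs) nothing ≡ betaSum bs
peaks-betaChain y ([] , []) [] = refl
peaks-betaChain {[] ∷ _} y (() ∷ _ , _) _
peaks-betaChain {(a ∷ w) ∷ bs} y (ends ∷ ends* , above ∷ sorted) (y<lst ∷ _) = begin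
    peaks (just y) ((a ∷ w) ++ concat bs) nothing
  ≡⟨ peaks-++ (just y) (a ∷ w) (concat bs) nothing ⟩
    peaks (just y) (a ∷ w) (firstOr (concat bs) nothing) + peaks (lastOr (a ∷ w) (just y)) (concat bs) nothing
  ≡⟨ cong₂ _+_ (peaks-cong {r′ = nothing} a w firstIsPeak (firstOr-betaChain-above ends* above))
               (cong (λ l → peaks l (concat bs) nothing) (lastOr-∷ a w (just y))) ⟩
    betaPeaks (a ∷ w) + peaks (just (lst (a ∷ w))) (concat bs) nothing
  ≡⟨ cong (betaPeaks (a ∷ w) +_) (peaks-betaChain (lst (a ∷ w)) (ends* , sorted) above) ⟩
    betaSum ((a ∷ w) ∷ bs)
  ∎
  where
  open ≡-Reasoning
  y<a : y < a
  y<a = <-≤-trans y<lst (All.head (EndsWithMin⇒lst≤ {a ∷ w} ends))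
  firstIsPeak : gtM a (just y) ≡ gtM a (just 0)
  firstIsPeak = trans (<⇒<ᵇ≡true y<a) (sym (<⇒<ᵇ≡true (≤-<-trans z≤n y<a)))

Mtilde-blocks : ∀ {as bs} → AlphaChain as → BetaChain bs → All (All (1 <_)) as → All (All (1 <_)) bs →
                Mtilde (concat as ++ 1 ∷ concat bs) ≡ blockPeaks as bs
Mtilde-blocks {as} {bs} α-chain β-chain@(ends , _) as>1 bs>1 = begin
    Mtilde (concat as ++ 1 ∷ concat bs)
  ≡⟨ peaksFrom≡peaks nothing (concat as ++ 1 ∷ concat bs) ⟩
    peaks nothing (concat as ++ 1 ∷ concat bs) nothing
  ≡⟨ peaks-alphaChain nothing (concat bs) nothing α-chain as>1 (All.universal (λ _ → refl) as) ⟩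
    alphaSum as + peaks (lastOr (concat as) nothing) (1 ∷ concat bs) nothing
  ≡⟨ cong (alphaSum as +_) oneIsNoPeak ⟩
    alphaSum as + peaks (just 1) (concat bs) nothing
  ≡⟨ cong (alphaSum as +_) (peaks-betaChain 1 β-chain lsts>1) ⟩
    blockPeaks as bs
  ∎
  where
  open ≡-Reasoning
  oneIsNoPeak : peaks (lastOr (concat as) nothing) (1 ∷ concat bs) nothing ≡ peaks (just 1) (concat bs) nothing
  oneIsNoPeak rewrite lastOr-not-below-1 {nothing} refl (All.concat⁺ as>1) = refl
  lsts>1 : All (λ b → 1 < lst b) bs
  lsts>1 = All.zipWith (λ (e , b>1) → All⇒lst e b>1) (ends , bs>1)

alphaSum-↭ : ∀ {as as′} → as ↭ as′ → alphaSum as ≡ alphaSum as′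
alphaSum-↭ = sum-↭ ∘ ↭.map⁺ alphaPeaks

betaSum-↭ : ∀ {bs bs′} → bs ↭ bs′ → betaSum bs ≡ betaSum bs′
betaSum-↭ = sum-↭ ∘ ↭.map⁺ betaPeaks

blockPeaks-move-alpha : ∀ {as bs as′ bs′ α} → as ↭ α ∷ as′ → bs′ ↭ reverse α ∷ bs →
                        blockPeaks as′ bs′ ≡ blockPeaks as bs
blockPeaks-move-alpha {as} {bs} {as′} {bs′} {α} as↭ bs′↭ = begin
    alphaSum as′ + betaSum bs′
  ≡⟨ cong (alphaSum as′ +_) (betaSum-↭ bs′↭) ⟩
    alphaSum as′ + (betaPeaks (reverse α) + betaSum bs)
  ≡⟨ cong (λ k → alphaSum as′ + (k + betaSum bs)) (betaPeaks-reverse α) ⟩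
    alphaSum as′ + (alphaPeaks α + betaSum bs)
  ≡⟨ +-assoc (alphaSum as′) (alphaPeaks α) (betaSum bs) ⟨
    (alphaSum as′ + alphaPeaks α) + betaSum bs
  ≡⟨ cong (_+ betaSum bs) (+-comm (alphaSum as′) (alphaPeaks α)) ⟩
    (alphaPeaks α + alphaSum as′) + betaSum bs
  ≡⟨ cong (_+ betaSum bs) (alphaSum-↭ as↭) ⟨
    alphaSum as + betaSum bs
  ∎
  where open ≡-Reasoning

blockPeaks-move-beta : ∀ {as bs as′ bs′ β} → as′ ↭ reverse β ∷ as → bs ↭ β ∷ bs′ →
                       blockPeaks as′ bs′ ≡ blockPeaks as bs
blockPeaks-move-beta {as} {bs} {as′} {bs′} {β} as′↭ bs↭ = begin
    alphaSum as′ + betaSum bs′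
  ≡⟨ cong (_+ betaSum bs′) (alphaSum-↭ as′↭) ⟩
    (alphaPeaks (reverse β) + alphaSum as) + betaSum bs′
  ≡⟨ cong (λ k → (k + alphaSum as) + betaSum bs′) (alphaPeaks-reverse β) ⟩
    (betaPeaks β + alphaSum as) + betaSum bs′
  ≡⟨ cong (_+ betaSum bs′) (+-comm (betaPeaks β) (alphaSum as)) ⟩
    (alphaSum as + betaPeaks β) + betaSum bs′
  ≡⟨ +-assoc (alphaSum as) (betaPeaks β) (betaSum bs′) ⟩
    alphaSum as + (betaPeaks β + betaSum bs′)
  ≡⟨ cong (alphaSum as +_) (betaSum-↭ bs↭) ⟨
    alphaSum as + betaSum bs
  ∎
  where open ≡-Reasoning

-- The α- and β-blocks of a word

concat-alphasGo : ∀ h acc w → concat (alphasGo h acc w) ≡ h ∷ reverse acc ++ w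
concat-alphasGo h acc []      = cong (h ∷_) (trans (++-identityʳ _) (sym (++-identityʳ _)))
concat-alphasGo h acc (y ∷ w) with y <ᵇ h
... | true  = cong (λ v → h ∷ reverse acc ++ v) (concat-alphasGo y [] w)
... | false = begin
    concat (alphasGo h (y ∷ acc) w)  ≡⟨ concat-alphasGo h (y ∷ acc) w ⟩
    h ∷ reverse (y ∷ acc) ++ w       ≡⟨ cong (λ v → h ∷ v ++ w) (unfold-reverse y acc) ⟩
    h ∷ (reverse acc ++ [ y ]) ++ w  ≡⟨ cong (h ∷_) (++-assoc (reverse acc) [ y ] w) ⟩
    h ∷ reverse acc ++ y ∷ w         ∎
  where open ≡-Reasoning

concat-alphas : ∀ A → concat (alphas A) ≡ A
concat-alphas []      = refl
concat-alphas (a ∷ w) = concat-alphasGo a [] w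

alphasGo-chain : ∀ h acc w → All (h ≤_) acc →
                 AlphaChain (alphasGo h acc w) × All (λ a → hd a ≤ h) (alphasGo h acc w)
alphasGo-chain h acc [] h≤acc = (startsWithMin (All-reverse⁺ h≤acc) ∷ [] , [] ∷ []) , ≤-refl ∷ []
alphasGo-chain h acc (y ∷ w) h≤acc with y <ᵇ h in y<ᵇh
... | false = alphasGo-chain h (y ∷ acc) w (<ᵇ≡false⇒≤ y<ᵇh ∷ h≤acc)
... | true with alphasGo-chain y [] w [] | <ᵇ≡true⇒< y<ᵇh
...   | (starts , sorted) , ≤y | y<h =
  (startsWithMin (All-reverse⁺ h≤acc) ∷ starts , All.map (λ a≤y → ≤-<-trans a≤y y<h) ≤y ∷ sorted) ,
  ≤-refl ∷ All.map (λ a≤y → ≤-trans a≤y (<⇒≤ y<h)) ≤y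

alphas-chain : ∀ A → AlphaChain (alphas A)
alphas-chain []      = [] , []
alphas-chain (a ∷ w) = proj₁ (alphasGo-chain a [] w [])

concat-map-reverse-reverse : ∀ (xss : List (List ℕ)) → concat (map reverse (reverse xss)) ≡ reverse (concat xss)
concat-map-reverse-reverse []         = refl
concat-map-reverse-reverse (xs ∷ xss) = begin
    concat (map reverse (reverse (xs ∷ xss)))
  ≡⟨ cong (concat ∘ map reverse) (unfold-reverse xs xss) ⟩
    concat (map reverse (reverse xss ++ [ xs ]))
  ≡⟨ cong concat (map-++ reverse (reverse xss) [ xs ]) ⟩
    concat (map reverse (reverse xss) ++ [ reverse xs ])
  ≡⟨ sym (concat-++ (map reverse (reverse xss)) [ reverse xs ]) ⟩
    concat (map reverse (reverse xss)) ++ reverse xs ++ []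
  ≡⟨ cong₂ _++_ (concat-map-reverse-reverse xss) (++-identityʳ (reverse xs)) ⟩
    reverse (concat xss) ++ reverse xs
  ≡⟨ sym (reverse-++ xs (concat xss)) ⟩
    reverse (concat (xs ∷ xss))
  ∎
  where open ≡-Reasoning

concat-betas : ∀ B → concat (betas B) ≡ B
concat-betas B = begin
  concat (betas B)                 ≡⟨ concat-map-reverse-reverse (alphas (reverse B)) ⟩
  reverse (concat (alphas (reverse B)))  ≡⟨ cong reverse (concat-alphas (reverse B)) ⟩
  reverse (reverse B)              ≡⟨ reverse-involutive B ⟩
  B                                ∎
  where open ≡-Reasoning

reverse-AlphaChain : ∀ {as} → AlphaChain as → BetaChain (map reverse (reverse as))
reverse-AlphaChain (starts , sorted) =
  All.map⁺ (All-reverse⁺ (All.map StartsWithMin⇒EndsWithMin-reverse starts)) ,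
  AllPairs.map⁺ (AllPairs.map (λ {a} {a′} a<a′ → subst₂ _<_ (sym (lst-reverse a)) (sym (lst-reverse a′)) a<a′)
                              (AllPairs-reverse⁺ sorted))

betas-chain : ∀ B → BetaChain (betas B)
betas-chain B = reverse-AlphaChain (alphas-chain (reverse B))

alphasGo-hd : ∀ h acc w → Any (λ a → hd a ≡ h) (alphasGo h acc w)
alphasGo-hd h acc []      = here refl
alphasGo-hd h acc (y ∷ w) with y <ᵇ h
... | true  = here refl
... | false = alphasGo-hd h (y ∷ acc) w

alphasGo-LRmin : ∀ h acc p x s → All (x <_) p → x < h → Any (λ a → hd a ≡ x) (alphasGo h acc (p ++ x ∷ s))
alphasGo-LRmin h acc []      x s []          x<h rewrite <⇒<ᵇ≡true x<h = there (alphasGo-hd x [] s)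
alphasGo-LRmin h acc (y ∷ p) x s (x<y ∷ x<p) x<h with y <ᵇ h
... | true  = there (alphasGo-LRmin y [] p x s x<p x<y)
... | false = alphasGo-LRmin h (y ∷ acc) p x s x<p x<h

LRmin⇒alphaHead : ∀ {x A} → LRmin x A → Any (λ a → hd a ≡ x) (alphas A)
LRmin⇒alphaHead ([]    , s , refl , [])          = alphasGo-hd _ [] s
LRmin⇒alphaHead (y ∷ p , s , refl , x<y ∷ x<p) = alphasGo-LRmin y [] p _ s x<p x<y

RLmin⇒betaLast : ∀ {x B} → RLmin x B → Any (λ b → lst b ≡ x) (betas B)
RLmin⇒betaLast r = Any.map⁺ (Any.reverse⁺ (Any.map (λ {a} hd≡x → trans (lst-reverse a) hd≡x)
                                                   (LRmin⇒alphaHead (RLmin⇒LRmin-reverse r))))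

-- Removing and inserting blocks

insertBefore-↭ : ∀ P (c : List ℕ) bs → insertBefore P c bs ↭ c ∷ bs
insertBefore-↭ P c []       = ↭-refl
insertBefore-↭ P c (b ∷ bs) with P b
... | true  = ↭-refl
... | false = ↭-trans (prep b (insertBefore-↭ P c bs)) (swap b c ↭-refl)

insertBefore-AllPairs : ∀ {ℓ} {R : Rel (List ℕ) ℓ} P {c bs} → Transitive R →
                        (∀ b → P b ≡ true → R c b) → All (λ b → P b ≡ false → R b c) bs →
                        AllPairs R bs → AllPairs R (insertBefore P c bs)
insertBefore-AllPairs P {bs = []}     _     _         []         []         = [] ∷ []
insertBefore-AllPairs P {c} {b ∷ bs} trans true⇒R  (false⇒R ∷ fs) (rb ∷ rbs) with P b in Pb
... | true  = (true⇒R b Pb ∷ All.map (trans (true⇒R b Pb)) rb) ∷ rb ∷ rbs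
... | false = All-resp-↭ (↭-sym (insertBefore-↭ P c bs)) (false⇒R refl ∷ rb) ∷
              insertBefore-AllPairs P trans true⇒R fs rbs

extract-just : ∀ P bs {c cs} → extract P bs ≡ just (c , cs) → P c ≡ true × bs ↭ c ∷ cs
extract-just P (b ∷ bs) eq with P b in Pb
extract-just P (b ∷ bs) refl | true = Pb , ↭-refl
extract-just P (b ∷ bs) eq   | false with extract P bs in eq′
extract-just P (b ∷ bs) refl | false | just _ with extract-just P bs eq′
... | Pc , bs↭ = Pc , ↭-trans (prep b bs↭) (swap b _ ↭-refl)

extract-AllPairs : ∀ {ℓ} {R : Rel (List ℕ) ℓ} P bs {c cs} → extract P bs ≡ just (c , cs) →
                   AllPairs R bs → AllPairs R cs
extract-AllPairs P (b ∷ bs) eq   (rb ∷ rbs) with P b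
extract-AllPairs P (b ∷ bs) refl (rb ∷ rbs) | true = rbs
extract-AllPairs P (b ∷ bs) eq   (rb ∷ rbs) | false with extract P bs in eq′
extract-AllPairs P (b ∷ bs) refl (rb ∷ rbs) | false | just _ =
  All.tail (All-resp-↭ (proj₂ (extract-just P bs eq′)) rb) ∷ extract-AllPairs P bs eq′ rbs

extract-nothing : ∀ P bs → extract P bs ≡ nothing → All (λ b → P b ≡ false) bs
extract-nothing P []       _  = []
extract-nothing P (b ∷ bs) eq with P b in Pb
extract-nothing P (b ∷ bs) () | true
... | false with extract P bs in eq′
extract-nothing P (b ∷ bs) () | false | just _
... | nothing = Pb ∷ extract-nothing P bs eq′

-- The map ψ

splitAt1-++-∷ : ∀ A B → All (1 <_) A → splitAt1 (A ++ 1 ∷ B) ≡ (A , B)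
splitAt1-++-∷ []      B []          = refl
splitAt1-++-∷ (a ∷ A) B (1<a ∷ A>1)
  rewrite ≢⇒⌊≟⌋≡false (λ a≡1 → <-irrefl (sym a≡1) 1<a) | splitAt1-++-∷ A B A>1 = refl

ψ-Spec : ℕ → List ℕ → List ℕ → Set
ψ-Spec x σ τ = (LRmin x σ → RLmin x τ) × (RLmin x σ → LRmin x τ) × (Mtilde τ ≡ Mtilde σ)

module _ {A B : List ℕ} (A>1 : All (1 <_) A) (B>1 : All (1 <_) B)
         (A#B : ∀ {a b} → a ∈ A → b ∈ B → a ≢ b) where

  private
    As Bs : List (List ℕ)
    As = alphas A
    Bs = betas B

    As>1 : All (All (1 <_)) As
    As>1 = All.concat⁻ (subst (All (1 <_)) (sym (concat-alphas A)) A>1)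

    Bs>1 : All (All (1 <_)) Bs
    Bs>1 = All.concat⁻ (subst (All (1 <_)) (sym (concat-betas B)) B>1)

    ∈As⇒∈A : ∀ {x a} → x ∈ a → a ∈ As → x ∈ A
    ∈As⇒∈A x∈a a∈As = subst (_ ∈_) (concat-alphas A) (∈-concat⁺′ x∈a a∈As)

    ∈Bs⇒∈B : ∀ {x b} → x ∈ b → b ∈ Bs → x ∈ B
    ∈Bs⇒∈B x∈b b∈Bs = subst (_ ∈_) (concat-betas B) (∈-concat⁺′ x∈b b∈Bs)

    Mtilde-σ : Mtilde (A ++ 1 ∷ B) ≡ blockPeaks As Bs
    Mtilde-σ = trans (cong₂ (λ u v → Mtilde (u ++ 1 ∷ v)) (sym (concat-alphas A)) (sym (concat-betas B)))
                     (Mtilde-blocks (alphas-chain A) (betas-chain B) As>1 Bs>1)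

    ∈A⇒¬RLmin : ∀ {x} → x ∈ A → ¬ RLmin x (A ++ 1 ∷ B)
    ∈A⇒¬RLmin x∈A m with RLmin-++-∷ A B (<⇒≤ (All.lookup A>1 x∈A)) m
    ... | inj₁ refl = <-irrefl refl (All.lookup A>1 x∈A)
    ... | inj₂ mB   = A#B x∈A (RLmin⇒∈ mB) refl

    ∈B⇒¬LRmin : ∀ {x} → x ∈ B → ¬ LRmin x (A ++ 1 ∷ B)
    ∈B⇒¬LRmin x∈B m with LRmin-++-∷ A B (<⇒≤ (All.lookup B>1 x∈B)) m
    ... | inj₁ refl = <-irrefl refl (All.lookup B>1 x∈B)
    ... | inj₂ mA   = A#B (LRmin⇒∈ mA) x∈B refl

    -- x ∈ A is the minimum of no β-block, so every comparison with x made by insertBefore is strict.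
    insert-reversed-alpha : ∀ {x α} → x ∈ A → StartsWithMin α → hd α ≡ x →
                            BetaChain (insertBefore (λ b → x <ᵇ lst b) (reverse α) Bs)
    insert-reversed-alpha {x} {α} x∈A startsα hdα≡x =
      All-resp-↭ (↭-sym (insertBefore-↭ _ (reverse α) Bs)) (StartsWithMin⇒EndsWithMin-reverse startsα ∷ ends) ,
      insertBefore-AllPairs (λ b → x <ᵇ lst b) <-trans x<⇒ (All.tabulate ≮x⇒) sorted
      where
      ends : All EndsWithMin Bs
      ends = proj₁ (betas-chain B)
      sorted : AllPairs (λ b b′ → lst b < lst b′) Bs
      sorted = proj₂ (betas-chain B)
      lst-α : lst (reverse α) ≡ x
      lst-α = trans (lst-reverse α) hdα≡x
      x<⇒ : ∀ b → (x <ᵇ lst b) ≡ true → lst (reverse α) < lst b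
      x<⇒ b x<b = subst (_< lst b) (sym lst-α) (<ᵇ≡true⇒< x<b)
      ≮x⇒ : ∀ {b} → b ∈ Bs → (x <ᵇ lst b) ≡ false → lst b < lst (reverse α)
      ≮x⇒ {b} b∈Bs x≮b = subst (lst b <_) (sym lst-α)
        (≤∧≢⇒< (<ᵇ≡false⇒≤ x≮b) (λ b≡x → A#B x∈A (∈Bs⇒∈B (lst∈ (All.lookup ends b∈Bs)) b∈Bs) (sym b≡x)))

    insert-reversed-beta : ∀ {x β} → x ∈ B → EndsWithMin β → lst β ≡ x →
                           AlphaChain (insertBefore (λ a → hd a <ᵇ x) (reverse β) As)
    insert-reversed-beta {x} {β} x∈B endsβ lstβ≡x =
      All-resp-↭ (↭-sym (insertBefore-↭ _ (reverse β) As)) (endsβ ∷ starts) ,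
      insertBefore-AllPairs (λ a → hd a <ᵇ x) (flip <-trans) <x⇒ (All.tabulate ≮x⇒) sorted
      where
      starts : All StartsWithMin As
      starts = proj₁ (alphas-chain A)
      sorted : AllPairs (λ a a′ → hd a′ < hd a) As
      sorted = proj₂ (alphas-chain A)
      <x⇒ : ∀ a → (hd a <ᵇ x) ≡ true → hd a < hd (reverse β)
      <x⇒ a a<x = subst (hd a <_) (sym lstβ≡x) (<ᵇ≡true⇒< a<x)
      ≮x⇒ : ∀ {a} → a ∈ As → (hd a <ᵇ x) ≡ false → hd (reverse β) < hd a
      ≮x⇒ {a} a∈As a≮x = subst (_< hd a) (sym lstβ≡x)
        (≤∧≢⇒< (<ᵇ≡false⇒≤ a≮x) (λ x≡a → A#B (∈As⇒∈A (hd∈ (All.lookup starts a∈As)) a∈As) x∈B (sym x≡a)))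

  ψ-alpha-case : ∀ {x α as} → extract (λ a → ⌊ hd a ≟ x ⌋) As ≡ just (α , as) →
                 ψ-Spec x (A ++ 1 ∷ B) (concat as ++ 1 ∷ concat (insertBefore (λ b → x <ᵇ lst b) (reverse α) Bs))
  ψ-alpha-case {x} {α} {as} eq with extract-just _ As eq
  ... | hdα≟x , As↭ = lr , ⊥-elim ∘ ∈A⇒¬RLmin x∈A , Mtilde-τ
    where
    hdα≡x : hd α ≡ x
    hdα≡x = ⌊≟⌋≡true⇒≡ {hd α} hdα≟x
    starts : All StartsWithMin (α ∷ as)
    starts = All-resp-↭ As↭ (proj₁ (alphas-chain A))
    α∷as>1 : All (All (1 <_)) (α ∷ as)
    α∷as>1 = All-resp-↭ As↭ As>1
    x∈A : x ∈ A
    x∈A = subst (_∈ A) hdα≡x (∈As⇒∈A (hd∈ (All.head starts)) (Any-resp-↭ (↭-sym As↭) (here refl)))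
    Bs′ : List (List ℕ)
    Bs′ = insertBefore (λ b → x <ᵇ lst b) (reverse α) Bs
    Bs′↭ : Bs′ ↭ reverse α ∷ Bs
    Bs′↭ = insertBefore-↭ _ (reverse α) Bs
    as-chain : AlphaChain as
    as-chain = All.tail starts , extract-AllPairs _ As eq (proj₂ (alphas-chain A))
    Bs′-chain : BetaChain Bs′
    Bs′-chain = insert-reversed-alpha x∈A (All.head starts) hdα≡x
    Bs′>1 : All (All (1 <_)) Bs′
    Bs′>1 = All-resp-↭ (↭-sym Bs′↭) (All-reverse⁺ (All.head α∷as>1) ∷ Bs>1)
    lr : LRmin x (A ++ 1 ∷ B) → RLmin x (concat as ++ 1 ∷ concat Bs′)
    lr _ = RLmin-++ˡ (concat as) (RLmin-++ˡ [ 1 ]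
             (subst (λ y → RLmin y (concat Bs′)) (trans (lst-reverse α) hdα≡x)
                    (BetaChain⇒RLmin Bs′-chain (Any-resp-↭ (↭-sym Bs′↭) (here refl)))))
    Mtilde-τ : Mtilde (concat as ++ 1 ∷ concat Bs′) ≡ Mtilde (A ++ 1 ∷ B)
    Mtilde-τ = begin
      Mtilde (concat as ++ 1 ∷ concat Bs′)  ≡⟨ Mtilde-blocks as-chain Bs′-chain (All.tail α∷as>1) Bs′>1 ⟩
      blockPeaks as Bs′                     ≡⟨ blockPeaks-move-alpha As↭ Bs′↭ ⟩
      blockPeaks As Bs                      ≡⟨ Mtilde-σ ⟨
      Mtilde (A ++ 1 ∷ B)                   ∎
      where open ≡-Reasoning

  ψ-beta-case : ∀ {x β bs} → extract (λ b → ⌊ lst b ≟ x ⌋) Bs ≡ just (β , bs) →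
                ψ-Spec x (A ++ 1 ∷ B) (concat (insertBefore (λ a → hd a <ᵇ x) (reverse β) As) ++ 1 ∷ concat bs)
  ψ-beta-case {x} {β} {bs} eq with extract-just _ Bs eq
  ... | lstβ≟x , Bs↭ = ⊥-elim ∘ ∈B⇒¬LRmin x∈B , rl , Mtilde-τ
    where
    lstβ≡x : lst β ≡ x
    lstβ≡x = ⌊≟⌋≡true⇒≡ {lst β} lstβ≟x
    ends : All EndsWithMin (β ∷ bs)
    ends = All-resp-↭ Bs↭ (proj₁ (betas-chain B))
    β∷bs>1 : All (All (1 <_)) (β ∷ bs)
    β∷bs>1 = All-resp-↭ Bs↭ Bs>1
    x∈B : x ∈ B
    x∈B = subst (_∈ B) lstβ≡x (∈Bs⇒∈B (lst∈ {β} (All.head ends)) (Any-resp-↭ (↭-sym Bs↭) (here refl)))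
    As′ : List (List ℕ)
    As′ = insertBefore (λ a → hd a <ᵇ x) (reverse β) As
    As′↭ : As′ ↭ reverse β ∷ As
    As′↭ = insertBefore-↭ _ (reverse β) As
    bs-chain : BetaChain bs
    bs-chain = All.tail ends , extract-AllPairs _ Bs eq (proj₂ (betas-chain B))
    As′-chain : AlphaChain As′
    As′-chain = insert-reversed-beta {β = β} x∈B (All.head ends) lstβ≡x
    As′>1 : All (All (1 <_)) As′
    As′>1 = All-resp-↭ (↭-sym As′↭) (All-reverse⁺ (All.head β∷bs>1) ∷ As>1)
    rl : RLmin x (A ++ 1 ∷ B) → LRmin x (concat As′ ++ 1 ∷ concat bs)
    rl _ = LRmin-++ʳ (1 ∷ concat bs)
             (subst (λ y → LRmin y (concat As′)) lstβ≡x
                    (AlphaChain⇒LRmin As′-chain (Any-resp-↭ (↭-sym As′↭) (here refl))))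
    Mtilde-τ : Mtilde (concat As′ ++ 1 ∷ concat bs) ≡ Mtilde (A ++ 1 ∷ B)
    Mtilde-τ = begin
      Mtilde (concat As′ ++ 1 ∷ concat bs)  ≡⟨ Mtilde-blocks As′-chain bs-chain As′>1 (All.tail β∷bs>1) ⟩
      blockPeaks As′ bs                     ≡⟨ blockPeaks-move-beta As′↭ Bs↭ ⟩
      blockPeaks As Bs                      ≡⟨ Mtilde-σ ⟨
      Mtilde (A ++ 1 ∷ B)                   ∎
      where open ≡-Reasoning

  ψ-fixed-case : ∀ {x} → 1 ≤ x → extract (λ a → ⌊ hd a ≟ x ⌋) As ≡ nothing →
                 extract (λ b → ⌊ lst b ≟ x ⌋) Bs ≡ nothing → ψ-Spec x (A ++ 1 ∷ B) (A ++ 1 ∷ B)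
  ψ-fixed-case {x} 1≤x noα noβ = lr , rl , refl
    where
    lr : LRmin x (A ++ 1 ∷ B) → RLmin x (A ++ 1 ∷ B)
    lr m with LRmin-++-∷ A B 1≤x m
    ... | inj₁ refl = A , B , refl , B>1
    ... | inj₂ mA   =
      ⊥-elim (All¬⇒¬Any (All.map ⌊≟⌋≡false⇒≢ (extract-nothing _ As noα)) (LRmin⇒alphaHead mA))
    rl : RLmin x (A ++ 1 ∷ B) → LRmin x (A ++ 1 ∷ B)
    rl m with RLmin-++-∷ A B 1≤x m
    ... | inj₁ refl = A , B , refl , A>1
    ... | inj₂ mB   =
      ⊥-elim (All¬⇒¬Any (All.map ⌊≟⌋≡false⇒≢ (extract-nothing _ Bs noβ)) (RLmin⇒betaLast mB))

  ψ-satisfies-Spec : ∀ {x} → 1 ≤ x → ψ-Spec x (A ++ 1 ∷ B) (ψ x (A ++ 1 ∷ B))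
  ψ-satisfies-Spec {x} 1≤x rewrite splitAt1-++-∷ A B A>1 with extract (λ a → ⌊ hd a ≟ x ⌋) As in eα
  ... | just _  = ψ-alpha-case eα
  ... | nothing with extract (λ b → ⌊ lst b ≟ x ⌋) Bs in eβ
  ...   | just _  = ψ-beta-case eβ
  ...   | nothing = ψ-fixed-case 1≤x eα eβ

↭-1…n⇒Unique×positive : ∀ {n σ} → σ ↭ map suc (upTo n) → Unique σ × All (0 <_) σ
↭-1…n⇒Unique×positive {n} σ↭ =
  Unique-resp-↭ (↭⇒↭ₛ (↭-sym σ↭)) (Unique.map⁺ suc-injective (Unique.upTo⁺ n)) ,
  All-resp-↭ (↭-sym σ↭) (All.map⁺ (All.universal (λ _ → z<s) (upTo n)))

letters-around-1 : ∀ A B → Unique (A ++ 1 ∷ B) → All (0 <_) (A ++ 1 ∷ B) →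
                   All (1 <_) A × All (1 <_) B × (∀ {a b} → a ∈ A → b ∈ B → a ≢ b)
letters-around-1 A B distinct positive with AllPairs-++⁻ A distinct
... | _ , 1∉B ∷ _ , A∉1∷B =
  All.zipWith (λ (0<a , a∉1∷B) → ≤∧≢⇒< 0<a (≢-sym (All.head a∉1∷B))) (All.++⁻ˡ A positive , A∉1∷B) ,
  All.zipWith (λ (0<b , 1≢b) → ≤∧≢⇒< 0<b 1≢b) (All.tail (All.++⁻ʳ A positive) , 1∉B) ,
  λ a∈A b∈B → All.lookup (All.tail (All.lookup A∉1∷B a∈A)) b∈B

lemma4p1 : (n : ℕ) (σ : List ℕ) → σ ↭ map suc (upTo n) →
           (x : ℕ) → 1 ≤ x → x ≤ n →
           (LRmin x σ → RLmin x (ψ x σ)) ×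
           (RLmin x σ → LRmin x (ψ x σ)) ×
           (Mtilde (ψ x σ) ≡ Mtilde σ)
lemma4p1 zero    σ _  x 1≤x x≤0 = ⊥-elim (<⇒≱ 1≤x x≤0)
lemma4p1 (suc n) σ σ↭ x 1≤x _
  with ∈-∃++ (Any-resp-↭ (↭-sym σ↭) (here refl)) | ↭-1…n⇒Unique×positive σ↭
... | A , B , refl | distinct , positive with letters-around-1 A B distinct positive
...   | A>1 , B>1 , A#B = ψ-satisfies-Spec A>1 B>1 A#B 1≤x
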